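{- $\mathcal{L}_{u}$ is expressively complete for all nonempty upward closed team properties: $\{\lVert\phi\rVert:\phi\in\mathcal{L}_u\}$ is exactly the set of all nonempty upward closed sets of teams over $\mathbb{P}$.
   Context: Fix a finite set $\mathbb{P}$ of propositional symbols. A valuation is $v:\mathbb{P}\to\{0,1\}$, extended by $v(\top)=1,v(\bot)=0$; a team is a set of valuations. $\lVert\phi\rVert$ is the set of teams satisfying $\phi$. A set $\mathcal{C}$ of teams is upward closed if $T\in\mathcal{C}$ and $S\supseteq T$ imply $S\in\mathcal{C}$. The logic $\mathcal{L}_u$ has grammar $\phi::=\top\mid\mathsf{x}\subseteqq\mathsf{p}\mid\phi\land\phi\mid\phi\sqcup\phi$, where $\mathsf{x}$ is a finite sequence of constants $\top,\bot$ and $\mathsf{p}$ a sequence of symbols of $\mathbb{P}$ without repetitions, $|\mathsf{x}|=|\mathsf{p}|$. Semantics: $T\models\top$ always; $T\models\mathsf{x}\subseteqq\mathsf{p}$ iff $T\neq\emptyset$ and for every $v\in T$ there is $v'\in T$ with $v(\mathsf{x})=v'(\mathsf{p})$; $\land$ as usual; $T\models\phi\sqcup\psi$ iff $T\models\phi$ or $T\models\psi$. -}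

module Defs where

open import Data.Nat using (ℕ)
open import Data.Bool using (Bool; true; false)
open import Data.Fin using (Fin)
open import Data.Vec using (Vec; lookup; map)
open import Data.Vec.Relation.Unary.Unique.Propositional using (Unique)
open import Data.Product using (Σ; _×_; ∃)
open import Data.Sum using (_⊎_)
open import Data.Unit using () renaming (⊤ to Unit)
open import Relation.Binary.PropositionalEquality using (_≡_)

-- Propositional symbols: 𝕡 = Fin n (a finite set of n symbols).
-- A valuation assigns a truth value (Bool, true = 1) to each symbol.
Valuation : ℕ → Set
Valuation n = Vec Bool n

-- A team is a set of valuations; since the set of valuations is finite,
-- a team is given by its (decidable) characteristic function.
Team : ℕ → Set
Team n = Valuation n → Bool

_∈T_ : ∀ {n} → Valuation n → Team n → Set
v ∈T T = T v ≡ true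

TeamSet : ℕ → Set
TeamSet n = Team n → Bool

_⊆T_ : ∀ {n} → Team n → Team n → Set
T ⊆T S = ∀ v → v ∈T T → v ∈T S

NonEmptyT : ∀ {n} → Team n → Set
NonEmptyT T = ∃ λ v → v ∈T T

-- Syntax of 𝓛_u.  The atom  x ⊆⊆ p  : x a sequence of constants ⊤/⊥
-- (encoded as Bool: true = ⊤, false = ⊥), p a sequence of symbols without
-- repetitions, of the same length k.
data Form (n : ℕ) : Set where
  ⊤f   : Form n
  incl : ∀ {k} (x : Vec Bool k) (p : Vec (Fin n) k) → Unique p → Form n
  _∧f_ : Form n → Form n → Form n
  _⊔f_ : Form n → Form n → Form n

evalSeq : ∀ {n k} → Valuation n → Vec (Fin n) k → Vec Bool k
evalSeq v p = map (lookup v) p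

-- Team semantics.  (For constants, v(x) = x since v(⊤)=1, v(⊥)=0.)
_⊨_ : ∀ {n} → Team n → Form n → Set
T ⊨ ⊤f = Unit
T ⊨ incl x p _ = NonEmptyT T ×
  (∀ v → v ∈T T → Σ (Valuation _) λ v' → v' ∈T T × (x ≡ evalSeq v' p))
T ⊨ (φ ∧f ψ) = (T ⊨ φ) × (T ⊨ ψ)
T ⊨ (φ ⊔f ψ) = (T ⊨ φ) ⊎ (T ⊨ ψ)

IsDenotation : ∀ {n} → Form n → TeamSet n → Set
IsDenotation φ C = ∀ T → (T ⊨ φ → C T ≡ true) × (C T ≡ true → T ⊨ φ)

UpwardClosed : ∀ {n} → TeamSet n → Set
UpwardClosed C = ∀ T S → C T ≡ true → T ⊆T S → C S ≡ true

NonEmptyTS : ∀ {n} → TeamSet n → Set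
NonEmptyTS C = ∃ λ T → C T ≡ true

{-# OPTIONS --safe #-}
-- Satisfaction of 𝓛_u is upward closed and holds in the full team, which gives
-- one inclusion.  Conversely, the atom  v ⊆⊆ ℙ  (all symbols, in order) holds in a
-- team exactly when v belongs to it, so the conjunction of these atoms over the
-- members of T defines the principal filter ↑T.  A nonempty upward closed C is the
-- finite union of the ↑T with T ∈ C, hence the disjunction of their definitions.
module Submission where

open import Defs
open import Data.Nat using (ℕ; zero; suc)
open import Data.Bool using (Bool; true; false) renaming (_≟_ to _≟ᵇ_)
open import Data.Fin using (Fin)
open import Data.Vec using (Vec; []; _∷_; _[_]≔_; replicate; allFin)
open import Data.Vec.Properties using (lookup∘update; lookup∘update′; map-lookup-allFin; ≡-dec)
import Data.Vec.Relation.Unary.All as Vecᴬ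
open import Data.Vec.Relation.Unary.Unique.Propositional using (Unique; _∷_)
open import Data.Vec.Relation.Unary.Unique.Propositional.Properties using (tabulate⁺)
open import Data.List using (List; []; _∷_; [_]; _++_; map; filter; foldr)
open import Data.List.Relation.Unary.All as All using (All; []; _∷_)
open import Data.List.Relation.Unary.All.Properties using (all-filter)
open import Data.List.Relation.Unary.Any using (Any; here; there)
import Data.List.Relation.Unary.Any.Properties as Any
open import Data.List.Membership.Propositional using (_∈_; lose; find)
open import Data.List.Membership.Propositional.Properties
  using (∈-++⁺ˡ; ∈-++⁺ʳ; ∈-map⁺; ∈-filter⁺; ∈-filter⁻)
open import Data.Product using (Σ; ∃; _×_; _,_; proj₁; proj₂)
open import Data.Sum using (_⊎_; inj₁; inj₂)
open import Data.Unit using (tt)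
open import Level using (Level)
open import Relation.Nullary using (yes; no; does)
open import Relation.Nullary.Decidable using (dec-true)
open import Relation.Unary using (Pred; Decidable)
open import Relation.Binary.PropositionalEquality using (_≡_; _≢_; refl; sym; trans; cong₂; subst)

private
  variable
    a p : Level
    A : Set a
    n : ℕ

sublists : List A → List (List A)
sublists []       = [ [] ]
sublists (x ∷ xs) = map (x ∷_) (sublists xs) ++ sublists xs

filter∈sublists : {P : Pred A p} (P? : Decidable P) (xs : List A) →
                  filter P? xs ∈ sublists xs
filter∈sublists P? []       = here refl
filter∈sublists P? (x ∷ xs) with does (P? x)
... | true  = ∈-++⁺ˡ (∈-map⁺ (x ∷_) (filter∈sublists P? xs))
... | false = ∈-++⁺ʳ _ (filter∈sublists P? xs)

allValuations : ∀ n → List (Valuation n)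
allValuations zero    = [ [] ]
allValuations (suc n) = map (true ∷_) (allValuations n) ++ map (false ∷_) (allValuations n)

∈-allValuations : (v : Valuation n) → v ∈ allValuations n
∈-allValuations []          = here refl
∈-allValuations (true ∷ v)  = ∈-++⁺ˡ (∈-map⁺ (true ∷_) (∈-allValuations v))
∈-allValuations (false ∷ v) = ∈-++⁺ʳ _ (∈-map⁺ (false ∷_) (∈-allValuations v))

fullTeam : Team n
fullTeam _ = true

module _ {n : ℕ} where
  open import Data.List.Membership.DecPropositional (≡-dec {n = n} _≟ᵇ_) using (_∈?_)

  teamOf : List (Valuation n) → Team n
  teamOf vs u = does (u ∈? vs)

  ∈-teamOf⁺ : ∀ {u} vs → u ∈ vs → u ∈T teamOf vs
  ∈-teamOf⁺ {u} vs = dec-true (u ∈? vs)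

  ∈-teamOf⁻ : ∀ {u} vs → u ∈T teamOf vs → u ∈ vs
  ∈-teamOf⁻ {u} vs u∈T with u ∈? vs | u∈T
  ... | yes u∈vs | _ = u∈vs
  ... | no _     | ()

membersOf : Team n → List (Valuation n)
membersOf T = filter (λ v → T v ≟ᵇ true) (allValuations _)

⊆-teamOf-membersOf : (T : Team n) → T ⊆T teamOf (membersOf T)
⊆-teamOf-membersOf T u u∈T =
  ∈-teamOf⁺ (membersOf T) (∈-filter⁺ _ (∈-allValuations u) u∈T)

evalSeq-update-fresh : ∀ {k q} (v : Valuation n) b (ps : Vec (Fin n) k) →
                       Vecᴬ.All (q ≢_) ps → evalSeq (v [ q ]≔ b) ps ≡ evalSeq v ps
evalSeq-update-fresh v b []       Vecᴬ.[]          = refl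
evalSeq-update-fresh v b (r ∷ ps) (q≢r Vecᴬ.∷ q∉ps) =
  cong₂ _∷_ (lookup∘update′ (λ r≡q → q≢r (sym r≡q)) v b) (evalSeq-update-fresh v b ps q∉ps)

evalSeq-surjective : ∀ {k} (ps : Vec (Fin n) k) → Unique ps →
                     (x : Vec Bool k) → ∃ λ v → evalSeq v ps ≡ x
evalSeq-surjective []       _             []      = replicate _ false , refl
evalSeq-surjective (q ∷ ps) (q∉ps ∷ uniq) (b ∷ x) with evalSeq-surjective ps uniq x
... | v , v[ps]≡x = v [ q ]≔ b ,
  cong₂ _∷_ (lookup∘update q v b) (trans (evalSeq-update-fresh v b ps q∉ps) v[ps]≡x)

fullTeam⊨ : (φ : Form n) → fullTeam ⊨ φ
fullTeam⊨ ⊤f               = tt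
fullTeam⊨ (incl x ps uniq) = (replicate _ false , refl) , λ _ _ →
  let v , v[ps]≡x = evalSeq-surjective ps uniq x in v , refl , sym v[ps]≡x
fullTeam⊨ (φ ∧f ψ)         = fullTeam⊨ φ , fullTeam⊨ ψ
fullTeam⊨ (φ ⊔f ψ)         = inj₁ (fullTeam⊨ φ)

⊨-upward : ∀ (φ : Form n) {T S} → T ⊆T S → T ⊨ φ → S ⊨ φ
⊨-upward ⊤f            T⊆S _ = tt
⊨-upward (incl x ps _) T⊆S ((w , w∈T) , witness) =
  (w , T⊆S w w∈T) , λ _ _ →
    let v , v∈T , x≡v[ps] = witness w w∈T in v , T⊆S v v∈T , x≡v[ps]
⊨-upward (φ ∧f ψ)      T⊆S (Tφ , Tψ) = ⊨-upward φ T⊆S Tφ , ⊨-upward ψ T⊆S Tψ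
⊨-upward (φ ⊔f ψ)      T⊆S (inj₁ Tφ) = inj₁ (⊨-upward φ T⊆S Tφ)
⊨-upward (φ ⊔f ψ)      T⊆S (inj₂ Tψ) = inj₂ (⊨-upward ψ T⊆S Tψ)

memberAtom : Valuation n → Form n
memberAtom {n} v = incl v (allFin n) (tabulate⁺ (λ i≡j → i≡j))

⊨-memberAtom⁺ : ∀ {v} {T : Team n} → v ∈T T → T ⊨ memberAtom v
⊨-memberAtom⁺ {v = v} v∈T = (v , v∈T) , λ _ _ → v , v∈T , sym (map-lookup-allFin v)

⊨-memberAtom⁻ : ∀ {v} {T : Team n} → T ⊨ memberAtom v → v ∈T T
⊨-memberAtom⁻ {T = T} ((w , w∈T) , witness) with witness w w∈T
... | v' , v'∈T , v≡v' =
  subst (_∈T T) (trans (sym (map-lookup-allFin v')) (sym v≡v')) v'∈T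

containsAll : List (Valuation n) → Form n
containsAll []       = ⊤f
containsAll (v ∷ vs) = memberAtom v ∧f containsAll vs

⊨-containsAll⁺ : ∀ {T : Team n} {vs} → All (_∈T T) vs → T ⊨ containsAll vs
⊨-containsAll⁺ []           = tt
⊨-containsAll⁺ (v∈T ∷ vs⊆T) = ⊨-memberAtom⁺ v∈T , ⊨-containsAll⁺ vs⊆T

⊨-containsAll⁻ : ∀ {T : Team n} vs → T ⊨ containsAll vs → All (_∈T T) vs
⊨-containsAll⁻ []       _          = []
⊨-containsAll⁻ (v ∷ vs) (Tv , Tvs) = ⊨-memberAtom⁻ Tv ∷ ⊨-containsAll⁻ vs Tvs

⊨-containsAll⇒⊇ : ∀ {T : Team n} vs → T ⊨ containsAll vs → teamOf vs ⊆T T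
⊨-containsAll⇒⊇ vs T⊨vs u u∈vs = All.lookup (⊨-containsAll⁻ vs T⊨vs) (∈-teamOf⁻ vs u∈vs)

⨆ : Form n → List (Form n) → Form n
⨆ = foldr _⊔f_

⊨-⨆⁺ : ∀ {T : Team n} φ {ψs} → Any (T ⊨_) ψs → T ⊨ ⨆ φ ψs
⊨-⨆⁺ φ (here Tψ)  = inj₁ Tψ
⊨-⨆⁺ φ (there Tψ) = inj₂ (⊨-⨆⁺ φ Tψ)

⊨-⨆⁻ : ∀ {T : Team n} φ ψs → T ⊨ ⨆ φ ψs → T ⊨ φ ⊎ Any (T ⊨_) ψs
⊨-⨆⁻ φ []       Tφ        = inj₁ Tφ
⊨-⨆⁻ φ (ψ ∷ ψs) (inj₁ Tψ) = inj₂ (here Tψ)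
⊨-⨆⁻ φ (ψ ∷ ψs) (inj₂ T⨆) with ⊨-⨆⁻ φ ψs T⨆
... | inj₁ Tφ  = inj₁ Tφ
... | inj₂ Tψs = inj₂ (there Tψs)

module _ {n : ℕ} (C : TeamSet n) where

  ∈C? : Decidable (λ vs → C (teamOf vs) ≡ true)
  ∈C? vs = C (teamOf vs) ≟ᵇ true

  teamsInC : List (List (Valuation n))
  teamsInC = filter ∈C? (sublists (allValuations n))

  -- The extra disjunct  containsAll (allValuations n)  keeps the disjunction
  -- nonempty; it only defines the full team, which lies in any nonempty upward
  -- closed C.
  characteristic : Form n
  characteristic = ⨆ (containsAll (allValuations n)) (map containsAll teamsInC)

  containsAll-sound : UpwardClosed C → ∀ {T} vs →
                      C (teamOf vs) ≡ true → T ⊨ containsAll vs → C T ≡ true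
  containsAll-sound up vs vs∈C T⊨vs = up (teamOf vs) _ vs∈C (⊨-containsAll⇒⊇ vs T⊨vs)

  allValuations∈C : NonEmptyTS C → UpwardClosed C → C (teamOf (allValuations n)) ≡ true
  allValuations∈C (T , T∈C) up =
    up T (teamOf (allValuations n)) T∈C λ u _ → ∈-teamOf⁺ (allValuations n) (∈-allValuations u)

  characteristic-sound : NonEmptyTS C → UpwardClosed C →
                         ∀ T → T ⊨ characteristic → C T ≡ true
  characteristic-sound nonEmpty up T T⊨χ
    with ⊨-⨆⁻ (containsAll (allValuations n)) (map containsAll teamsInC) T⊨χ
  ... | inj₁ T⊨all =
    containsAll-sound up (allValuations n) (allValuations∈C nonEmpty up) T⊨all
  ... | inj₂ T⊨some with vs , vs∈teamsInC , T⊨vs ← find (Any.map⁻ T⊨some) =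
    containsAll-sound up vs vs∈C T⊨vs
    where
    vs∈C : C (teamOf vs) ≡ true
    vs∈C = proj₂ (∈-filter⁻ ∈C? {xs = sublists (allValuations n)} vs∈teamsInC)

  characteristic-complete : UpwardClosed C → ∀ T → C T ≡ true → T ⊨ characteristic
  characteristic-complete up T T∈C =
    ⊨-⨆⁺ (containsAll (allValuations n)) (Any.map⁺ (lose members∈teamsInC T⊨members))
    where
    members∈teamsInC : membersOf T ∈ teamsInC
    members∈teamsInC = ∈-filter⁺ _ (filter∈sublists _ (allValuations n))
      (up T (teamOf (membersOf T)) T∈C (⊆-teamOf-membersOf T))

    T⊨members : T ⊨ containsAll (membersOf T)
    T⊨members = ⊨-containsAll⁺ (all-filter _ (allValuations n))

mainTheorem9 : (n : ℕ) (C : TeamSet n) →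
    ((Σ (Form n) λ φ → IsDenotation φ C) → NonEmptyTS C × UpwardClosed C) ×
    (NonEmptyTS C × UpwardClosed C → Σ (Form n) λ φ → IsDenotation φ C)
mainTheorem9 n C = definable⇒upwardClosed , upwardClosed⇒definable
  where
  definable⇒upwardClosed : (Σ (Form n) λ φ → IsDenotation φ C) →
                           NonEmptyTS C × UpwardClosed C
  definable⇒upwardClosed (φ , ‖φ‖≡C) =
    (fullTeam , proj₁ (‖φ‖≡C fullTeam) (fullTeam⊨ φ)) ,
    λ T S T∈C T⊆S → proj₁ (‖φ‖≡C S) (⊨-upward φ T⊆S (proj₂ (‖φ‖≡C T) T∈C))

  upwardClosed⇒definable : NonEmptyTS C × UpwardClosed C →
                           Σ (Form n) λ φ → IsDenotation φ C
  upwardClosed⇒definable (nonEmpty , up) = characteristic C , λ T →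
    characteristic-sound C nonEmpty up T , characteristic-complete C up T
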